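{- Let $k_1$ be a nonnegative integer, let $k_2,\dots,k_\ell$ be positive integers ($\ell\ge 1$), and let $D$ be a digraph with $\delta^+(D)\ge \sum_{i=1}^{\ell} k_i$. Then for every vertex $v\in V(D)$, $D$ contains (as a subdigraph) a path $P(k_1',k_2',\dots,k_\ell')$ with initial vertex $v$ such that $k_i'\ge k_i$ if $i$ is odd and $k_i'=k_i$ if $i$ is even.
   Context: Digraphs are finite, without loops or parallel arcs. $\delta^+(D)$ is the minimum out-degree. For a nonnegative integer $k_1$ and positive integers $k_2,\dots,k_\ell$, $P(k_1,\dots,k_\ell)$ denotes the oriented path obtained from an undirected path $v_1v_2\dots v_{\ell+1}$ by replacing, for each $i\in\{1,\dots,\ell\}$, the edge $v_iv_{i+1}$ by a directed path of length $k_i$ from $v_i$ to $v_{i+1}$ if $i$ is odd, and from $v_{i+1}$ to $v_i$ if $i$ is even (if $k_1=0$ then $v_1=v_2$). Its initial vertex is $v_1$. -}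

module Defs where

open import Data.Nat using (ℕ; zero; suc; _≤_; _%_)
open import Data.Bool using (Bool; true; false; T; not; if_then_else_)
open import Data.Fin using (Fin; zero; suc; inject₁; toℕ)
open import Data.List using (List; []; _∷_; _++_; length; filterᵇ; replicate; lookup)
open import Data.List as L using ()
open import Data.Vec as V using (Vec)
open import Function.Definitions using (Injective)
open import Relation.Binary.PropositionalEquality using (_≡_)

-- A finite digraph on vertex set Fin n: a Boolean arc relation without loops.
-- (Parallel arcs are impossible in this representation.)
record Digraph : Set where
  field
    n        : ℕ
    arc      : Fin n → Fin n → Bool
    loopless : ∀ u → arc u u ≡ false
open Digraph public

outdeg : (D : Digraph) → Fin (n D) → ℕ
outdeg D u = length (filterᵇ (arc D u) (L.allFin (n D)))

MinOutDegGE : Digraph → ℕ → Set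
MinOutDegGE D d = ∀ u → d ≤ outdeg D u

-- Orientation pattern of the edges v₁…v_{ℓ+1}-path expansion of P(k₁,…,k_ℓ):
-- the i-th block (i = 1,2,…) consists of kᵢ edges, oriented forward
-- (true : wⱼ → wⱼ₊₁) when i is odd and backward (false : wⱼ₊₁ → wⱼ) when i is even.
orientFrom : Bool → List ℕ → List Bool
orientFrom b []       = []
orientFrom b (k ∷ ks) = replicate k b ++ orientFrom (not b) ks

orientation : List ℕ → List Bool
orientation = orientFrom true

record ContainsOrientedPath (D : Digraph) (v : Fin (n D)) (ds : List Bool) : Set where
  field
    w       : Fin (suc (length ds)) → Fin (n D)
    distinct : Injective _≡_ _≡_ w
    initial : w zero ≡ v
    arcs    : ∀ (j : Fin (length ds)) →
              T (if lookup ds j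
                   then arc D (w (inject₁ j)) (w (suc j))
                   else arc D (w (suc j)) (w (inject₁ j)))

ContainsP : (D : Digraph) → Fin (n D) → List ℕ → Set
ContainsP D v ks = ContainsOrientedPath D v (orientation ks)

-- parity of a 0-based index: index j corresponds to paper index i = j+1,
-- so "i odd" ⇔ "j even".
PaperIndexOdd : ∀ {ℓ} → Fin ℓ → Set
PaperIndexOdd j = toℕ j % 2 ≡ 0

-- Build the path block by block inside a shrinking set A of unused vertices, keeping the
-- invariant that every vertex of A has at least (sum of the remaining blocks) out-neighbours
-- in A.  A forward block grows one arc at a time, deleting the current vertex.  For a
-- backward block of length k at v, let U be the set of vertices of A that reach v and take a
-- maximal forward path from v in A.  If it leaves U at some vertex y, walk forward to y and
-- continue inside A ─ U: an out-neighbour of a vertex outside U lies outside U, so no degree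
-- is lost, and the detour only lengthens the preceding forward block.  Otherwise the last
-- vertex t of the path has all its out-neighbours on the path, the earliest one closes a
-- cycle longer than k all of whose vertices reach v, and going round the cycle and then
-- along a path to v that avoids it yields a path into v of length at least k.  Its last k
-- arcs, read backwards from v, form the block; deleting those k vertices costs each vertex at
-- most k out-neighbours, and we continue from the far end of the block.

module Submission where

open import Defs
open import Data.Bool using (Bool; true; false; T; if_then_else_)
open import Data.Bool.Properties using (T-≡)
open import Data.Empty using (⊥-elim)
open import Data.Fin using (Fin; zero; suc; toℕ; inject₁; _≟_)
open import Data.Fin.Properties using (any?)
open import Data.Fin.Subset
  using (Subset; inside; outside; ⊤; _∈_; _∉_; _⊆_; _∩_; _∪_; _─_; _-_; ⁅_⁆; ∣_∣; Nonempty)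
  renaming (⊥ to ∅)
open import Data.Fin.Subset.Properties
  using (_∈?_; ∈⊤; ∉⊥; x∈⁅x⁆; x∈⁅y⁆⇒x≡y; x∈p∪q⁺; x∈p∪q⁻; x∈p∩q⁺; x∈p∩q⁻; p─q⊆p;
         x∈p∧x∉q⇒x∈p─q; x∈p∧x≢y⇒x∈p-y; ∩-identityˡ; nonempty?; Empty-unique; ∣⊥∣≡0; ∣⁅x⁆∣≡1;
         p⊆q⇒∣p∣≤∣q∣; ∣p─q∣≤∣p∣; p∩q≢∅⇒∣p─q∣<∣p∣; x∈p⇒∣p-x∣<∣p∣)
open import Data.List using (List; []; _∷_; [_]; _++_; length; replicate; filterᵇ)
import Data.List as List
open import Data.List.Properties using (++-identityʳ; length-++)
open import Data.List.Membership.Propositional using () renaming (_∈_ to _∈ₗ_; _∉_ to _∉ₗ_)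
open import Data.List.Membership.Propositional.Properties using (∈-++⁺ˡ; ∈-++⁺ʳ; ∈-++⁻)
open import Data.List.Relation.Binary.Disjoint.Propositional using (Disjoint)
open import Data.List.Relation.Binary.Permutation.Propositional
  using (_↭_; ↭-refl; ↭-reflexive; ↭-sym; ↭-trans; prep)
open import Data.List.Relation.Binary.Permutation.Propositional.Properties
  using (∈-resp-↭; All-resp-↭; ↭-length; ++-comm)
open import Data.List.Relation.Unary.All using (All; []; _∷_)
import Data.List.Relation.Unary.All as All
import Data.List.Relation.Unary.All.Properties as All
open import Data.List.Relation.Unary.Any using (here; there)
open import Data.Nat using (ℕ; zero; suc; _+_; _≤_; _<_; z≤n; s≤s)
import Data.Nat as ℕ
open import Data.Nat.Induction using (<-wellFounded)
open import Data.Nat.Properties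
  using (≤-refl; ≤-trans; ≤-reflexive; <⇒≢; ≤∧≢⇒<; n≤1+n; n<1+n; m≤m+n; m<n⇒m<1+n; m<1+n⇒m≤n;
         suc-injective; +-suc; +-comm; +-cancelˡ-≤; +-mono-≤; +-monoˡ-≤; +-monoʳ-≤; +-monoˡ-<;
         +-monoʳ-<; +-mono-≤-<; module ≤-Reasoning)
open import Data.Product using (Σ; ∃; _×_; _,_; proj₁; proj₂)
open import Data.Sum using (_⊎_; inj₁; inj₂; [_,_]′)
open import Data.Vec using (Vec; []; _∷_; here; there; tabulate; lookup; sum; toList)
open import Data.Vec.Properties using (lookup∘tabulate; []=⇒lookup; lookup⇒[]=)
open import Function using (_∘_)
open import Function.Bundles using (module Equivalence)
open import Function.Definitions using (Injective)
open import Induction.WellFounded using (Acc; acc)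
open import Relation.Binary.PropositionalEquality
  using (_≡_; _≢_; refl; sym; trans; cong; subst; ≢-sym)
open import Relation.Nullary using (Dec; yes; no; ¬_)
open import Relation.Nullary.Decidable using (map′; _×-dec_; T?; ⌊_⌋; fromWitness; toWitness)

open Equivalence using (to; from)

∉-++⁺ : ∀ {A : Set} {x : A} {xs ys} → x ∉ₗ xs → x ∉ₗ ys → x ∉ₗ xs ++ ys
∉-++⁺ {xs = xs} x∉xs x∉ys x∈ = [ x∉xs , x∉ys ]′ (∈-++⁻ xs x∈)

All-suffix : ∀ {A : Set} {P : A → Set} {xs ys} as → xs ≡ as ++ ys → All P xs → All P ys
All-suffix as refl = All.++⁻ʳ as

replicate-∷ʳ : ∀ {A : Set} m (x : A) → replicate m x ++ [ x ] ≡ replicate (suc m) x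
replicate-∷ʳ zero    x = refl
replicate-∷ʳ (suc m) x = cong (x ∷_) (replicate-∷ʳ m x)

replicate-+-++ : ∀ {A : Set} m n (x : A) xs →
                 replicate (m + n) x ++ xs ≡ replicate m x ++ replicate n x ++ xs
replicate-+-++ zero    n x xs = refl
replicate-+-++ (suc m) n x xs = cong (x ∷_) (replicate-+-++ m n x xs)

Conforms : ∀ {ℓ} → Vec ℕ ℓ → Vec ℕ ℓ → Set
Conforms k k′ = ∀ i → (PaperIndexOdd i → lookup k i ≤ lookup k′ i)
                    × (¬ PaperIndexOdd i → lookup k′ i ≡ lookup k i)

Conforms-refl : ∀ {ℓ} {k : Vec ℕ ℓ} → Conforms k k
Conforms-refl i = (λ _ → ≤-refl) , (λ _ → refl)

Conforms-head : ∀ {ℓ a a′ b b′} {k k′ : Vec ℕ ℓ} →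
                (a ≤ a′ → b ≤ b′) → Conforms (a ∷ k) (a′ ∷ k′) → Conforms (b ∷ k) (b′ ∷ k′)
Conforms-head b≤b′ conforms zero    = (b≤b′ ∘ proj₁ (conforms zero)) , (λ even → ⊥-elim (even refl))
Conforms-head b≤b′ conforms (suc i) = conforms (suc i)

Conforms-∷∷ : ∀ {ℓ a b} {k k′ : Vec ℕ ℓ} → Conforms k k′ → Conforms (a ∷ b ∷ k) (a ∷ b ∷ k′)
Conforms-∷∷ _        zero          = (λ _ → ≤-refl) , (λ _ → refl)
Conforms-∷∷ _        (suc zero)    = (λ ()) , (λ _ → refl)
-- PaperIndexOdd (suc (suc i)) reduces to PaperIndexOdd i.
Conforms-∷∷ conforms (suc (suc i)) = conforms i

x∈p─q⇒x∉q : ∀ {N} {x : Fin N} {p q : Subset N} → x ∈ p ─ q → x ∉ q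
x∈p─q⇒x∉q {p = _ ∷ _} {outside ∷ _} (there x∈p─q) (there x∈q) = x∈p─q⇒x∉q x∈p─q x∈q
x∈p─q⇒x∉q {p = _ ∷ _} {inside  ∷ _} (there x∈p─q) (there x∈q) = x∈p─q⇒x∉q x∈p─q x∈q

∣p∪q∣≤∣p∣+∣q∣ : ∀ {N} (p q : Subset N) → ∣ p ∪ q ∣ ≤ ∣ p ∣ + ∣ q ∣
∣p∪q∣≤∣p∣+∣q∣ []            []            = z≤n
∣p∪q∣≤∣p∣+∣q∣ (outside ∷ p) (outside ∷ q) = ∣p∪q∣≤∣p∣+∣q∣ p q
∣p∪q∣≤∣p∣+∣q∣ (outside ∷ p) (inside  ∷ q) =
  ≤-trans (s≤s (∣p∪q∣≤∣p∣+∣q∣ p q)) (≤-reflexive (sym (+-suc ∣ p ∣ ∣ q ∣)))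
∣p∪q∣≤∣p∣+∣q∣ (inside  ∷ p) (outside ∷ q) = s≤s (∣p∪q∣≤∣p∣+∣q∣ p q)
∣p∪q∣≤∣p∣+∣q∣ (inside  ∷ p) (inside  ∷ q) =
  s≤s (≤-trans (∣p∪q∣≤∣p∣+∣q∣ p q) (+-monoʳ-≤ ∣ p ∣ (n≤1+n ∣ q ∣)))

∣p∣≤∣p─q∣+∣q∣ : ∀ {N} (p q : Subset N) → ∣ p ∣ ≤ ∣ p ─ q ∣ + ∣ q ∣
∣p∣≤∣p─q∣+∣q∣ p q = ≤-trans (p⊆q⇒∣p∣≤∣q∣ p⊆[p─q]∪q) (∣p∪q∣≤∣p∣+∣q∣ (p ─ q) q)
  where
  p⊆[p─q]∪q : p ⊆ (p ─ q) ∪ q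
  p⊆[p─q]∪q {x} x∈p with x ∈? q
  ... | yes x∈q = x∈p∪q⁺ (inj₂ x∈q)
  ... | no  x∉q = x∈p∪q⁺ (inj₁ (x∈p∧x∉q⇒x∈p─q x∈p x∉q))

0<∣p∣⇒Nonempty : ∀ {N} {p : Subset N} → 0 < ∣ p ∣ → Nonempty p
0<∣p∣⇒Nonempty {N} {p} 0<∣p∣ with nonempty? p
... | yes p≢∅ = p≢∅
... | no  p≡∅ = ⊥-elim (<⇒≢ 0<∣p∣ (sym (trans (cong ∣_∣ (Empty-unique p≡∅)) (∣⊥∣≡0 N))))

∈-tabulate⁺ : ∀ {N} {f : Fin N → Bool} {x} → T (f x) → x ∈ tabulate f
∈-tabulate⁺ {f = f} {x} fx = lookup⇒[]= x (tabulate f) (trans (lookup∘tabulate f x) (to T-≡ fx))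

∈-tabulate⁻ : ∀ {N} {f : Fin N → Bool} {x} → x ∈ tabulate f → T (f x)
∈-tabulate⁻ {f = f} {x} x∈ = from T-≡ (trans (sym (lookup∘tabulate f x)) ([]=⇒lookup x∈))

∣tabulate∣≡length-filterᵇ : ∀ {A : Set} {N} (p : A → Bool) (g : Fin N → A) →
                             ∣ tabulate (λ i → p (g i)) ∣ ≡ length (filterᵇ p (List.tabulate g))
∣tabulate∣≡length-filterᵇ {N = zero}  p g = refl
∣tabulate∣≡length-filterᵇ {N = suc N} p g with p (g zero)
... | true  = cong suc (∣tabulate∣≡length-filterᵇ p (λ i → g (suc i)))
... | false = ∣tabulate∣≡length-filterᵇ p (λ i → g (suc i))

x∉p-x : ∀ {N} {x : Fin N} {p : Subset N} → x ∉ p - x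
x∉p-x {x = x} x∈ = x∈p─q⇒x∉q x∈ (x∈⁅x⁆ x)

All∈p-x⇒x∉ : ∀ {N} {x : Fin N} {p xs} → All (_∈ p - x) xs → x ∉ₗ xs
All∈p-x⇒x∉ xs∈p-x x∈xs = x∉p-x (All.lookup xs∈p-x x∈xs)

All∈p⇒All∈p-x : ∀ {N} {x : Fin N} {p xs} → All (_∈ p) xs → x ∉ₗ xs → All (_∈ p - x) xs
All∈p⇒All∈p-x xs∈p x∉xs = All.tabulate λ u∈ → x∈p∧x≢y⇒x∈p-y (All.lookup xs∈p u∈) λ { refl → x∉xs u∈ }

fromList : ∀ {N} → List (Fin N) → Subset N
fromList []       = ∅
fromList (x ∷ xs) = ⁅ x ⁆ ∪ fromList xs

∈-fromList⁺ : ∀ {N} {x : Fin N} {xs} → x ∈ₗ xs → x ∈ fromList xs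
∈-fromList⁺ {xs = y ∷ _} (here refl)  = x∈p∪q⁺ (inj₁ (x∈⁅x⁆ y))
∈-fromList⁺              (there x∈xs) = x∈p∪q⁺ (inj₂ (∈-fromList⁺ x∈xs))

∈-fromList⁻ : ∀ {N} {x : Fin N} {xs} → x ∈ fromList xs → x ∈ₗ xs
∈-fromList⁻ {xs = []}     x∈∅ = ⊥-elim (∉⊥ x∈∅)
∈-fromList⁻ {xs = y ∷ xs} x∈  with x∈p∪q⁻ ⁅ y ⁆ (fromList xs) x∈
... | inj₁ x∈⁅y⁆ = here (x∈⁅y⁆⇒x≡y y x∈⁅y⁆)
... | inj₂ x∈xs  = there (∈-fromList⁻ x∈xs)

∣fromList∣≤length : ∀ {N} (xs : List (Fin N)) → ∣ fromList xs ∣ ≤ length xs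
∣fromList∣≤length {N} []   = ≤-reflexive (∣⊥∣≡0 N)
∣fromList∣≤length (x ∷ xs) = ≤-trans (∣p∪q∣≤∣p∣+∣q∣ ⁅ x ⁆ (fromList xs))
                                     (+-mono-≤ (≤-reflexive (∣⁅x⁆∣≡1 x)) (∣fromList∣≤length xs))

∣p∣<length : ∀ {N} {p : Subset N} {xs z} → (∀ {x} → x ∈ p → x ∈ₗ xs) → z ∈ₗ xs → z ∉ p →
             ∣ p ∣ < length xs
∣p∣<length {p = p} {xs} {z} p⊆xs z∈xs z∉p = begin-strict
  ∣ p ∣                ≤⟨ p⊆q⇒∣p∣≤∣q∣ p⊆xs-z ⟩
  ∣ fromList xs - z ∣  <⟨ x∈p⇒∣p-x∣<∣p∣ (∈-fromList⁺ z∈xs) ⟩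
  ∣ fromList xs ∣      ≤⟨ ∣fromList∣≤length xs ⟩
  length xs            ∎
  where
  open ≤-Reasoning
  p⊆xs-z : p ⊆ fromList xs - z
  p⊆xs-z x∈p = x∈p∧x≢y⇒x∈p-y (∈-fromList⁺ (p⊆xs x∈p)) λ { refl → z∉p x∈p }

module _ (D : Digraph) where

  V : Set
  V = Fin (n D)

  _⟶_ : V → V → Set
  x ⟶ y = T (arc D x y)

  Step : Bool → V → V → Set
  Step b x y = T (if b then arc D x y else arc D y x)

  open import Data.List.Membership.DecPropositional (_≟_ {n D}) using () renaming (_∈?_ to _∈ₗ?_)

  private
    variable
      a c t u v w x y z : V
      cs xs ys zs : List V
      ds ds′ : List Bool
      A B : Subset (n D)

  ⟶-irrefl : x ⟶ y → x ≢ y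
  ⟶-irrefl {x} x⟶x refl = subst T (loopless D x) x⟶x

  -- Out-degrees inside a vertex set

  N⁺ : V → Subset (n D)
  N⁺ u = tabulate (arc D u)

  deg : Subset (n D) → V → ℕ
  deg A u = ∣ A ∩ N⁺ u ∣

  MinOutDegIn : Subset (n D) → ℕ → Set
  MinOutDegIn A d = ∀ {u} → u ∈ A → d ≤ deg A u

  deg-⊤ : deg ⊤ u ≡ outdeg D u
  deg-⊤ {u} = trans (cong ∣_∣ (∩-identityˡ (N⁺ u))) (∣tabulate∣≡length-filterᵇ (arc D u) (λ i → i))

  MinOutDegIn-⊤ : ∀ {d} → MinOutDegGE D d → MinOutDegIn ⊤ d
  MinOutDegIn-⊤ {d} δ {u} _ = subst (d ≤_) (sym deg-⊤) (δ u)

  outNeighbour : 0 < deg A u → Σ V λ w → w ∈ A × u ⟶ w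
  outNeighbour {A} {u} 0<deg with 0<∣p∣⇒Nonempty 0<deg
  ... | w , w∈ with x∈p∩q⁻ A (N⁺ u) w∈
  ...   | w∈A , w∈N⁺ = w , w∈A , ∈-tabulate⁻ w∈N⁺

  deg-mono : (∀ {w} → w ∈ A → u ⟶ w → w ∈ B) → deg A u ≤ deg B u
  deg-mono {A} {u} A⇒B = p⊆q⇒∣p∣≤∣q∣ λ w∈ →
    let w∈A , w∈N⁺ = x∈p∩q⁻ A (N⁺ u) w∈ in x∈p∩q⁺ (A⇒B w∈A (∈-tabulate⁻ w∈N⁺) , w∈N⁺)

  deg-─ : ∀ A S u → deg A u ≤ deg (A ─ S) u + ∣ S ∣
  deg-─ A S u = ≤-trans (∣p∣≤∣p─q∣+∣q∣ (A ∩ N⁺ u) S) (+-monoˡ-≤ ∣ S ∣ (p⊆q⇒∣p∣≤∣q∣ A∩N⁺─S⊆))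
    where
    A∩N⁺─S⊆ : (A ∩ N⁺ u) ─ S ⊆ (A ─ S) ∩ N⁺ u
    A∩N⁺─S⊆ w∈ with x∈p∩q⁻ A (N⁺ u) (p─q⊆p _ S w∈)
    ... | w∈A , w∈N⁺ = x∈p∩q⁺ (x∈p∧x∉q⇒x∈p─q w∈A (x∈p─q⇒x∉q w∈) , w∈N⁺)

  MinOutDegIn-─ : ∀ {s d} S → MinOutDegIn A (s + d) → ∣ S ∣ ≤ s → MinOutDegIn (A ─ S) d
  MinOutDegIn-─ {A} {s} {d} S δ ∣S∣≤s {u} u∈ = +-cancelˡ-≤ s d (deg (A ─ S) u) (begin
    s + d                  ≤⟨ δ (p─q⊆p A S u∈) ⟩
    deg A u                ≤⟨ deg-─ A S u ⟩
    deg (A ─ S) u + ∣ S ∣  ≤⟨ +-monoʳ-≤ (deg (A ─ S) u) ∣S∣≤s ⟩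
    deg (A ─ S) u + s      ≡⟨ +-comm (deg (A ─ S) u) s ⟩
    s + deg (A ─ S) u      ∎)
    where open ≤-Reasoning

  -- Simple paths

  -- The index lists the vertices after the first one.
  data DPath : V → V → List V → Set where
    []   : DPath x x []
    step : x ⟶ y → x ∉ₗ y ∷ ys → DPath y z ys → DPath x z (y ∷ ys)

  data OPath : V → List Bool → V → List V → Set where
    []   : OPath x [] x []
    step : ∀ {b} → Step b x y → x ∉ₗ y ∷ ys → OPath y ds z ys → OPath x (b ∷ ds) z (y ∷ ys)

  DPath-start∉ : DPath x z xs → x ∉ₗ xs
  DPath-start∉ []            ()
  DPath-start∉ (step _ x∉ _) = x∉

  DPath-end∈ : DPath x z xs → z ∈ₗ x ∷ xs
  DPath-end∈ []           = here refl
  DPath-end∈ (step _ _ P) = there (DPath-end∈ P)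

  OPath-start∉ : OPath x ds z xs → x ∉ₗ xs
  OPath-start∉ []            ()
  OPath-start∉ (step _ x∉ _) = x∉

  DPath-++ : DPath x y xs → DPath y z ys → Disjoint (x ∷ xs) ys → DPath x z (xs ++ ys)
  DPath-++ []                Q _     = Q
  DPath-++ (step x⟶ x∉ P) Q xs#ys =
    step x⟶ (∉-++⁺ x∉ λ x∈ys → xs#ys (here refl , x∈ys))
            (DPath-++ P Q λ (u∈ , u∈ys) → xs#ys (there u∈ , u∈ys))

  OPath-++ : OPath x ds y xs → OPath y ds′ z ys → Disjoint (x ∷ xs) ys → OPath x (ds ++ ds′) z (xs ++ ys)
  OPath-++ []            Q _     = Q
  OPath-++ (step s x∉ P) Q xs#ys =
    step s (∉-++⁺ x∉ λ x∈ys → xs#ys (here refl , x∈ys))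
           (OPath-++ P Q λ (u∈ , u∈ys) → xs#ys (there u∈ , u∈ys))

  splitAt : DPath x z xs → c ∈ₗ x ∷ xs →
            Σ (List V) λ as → Σ (List V) λ bs →
              xs ≡ as ++ bs × DPath x c as × DPath c z bs × Disjoint (x ∷ as) bs
  splitAt P (here refl) = [] , _ , refl , [] , P , λ { (here refl , x∈) → DPath-start∉ P x∈ }
  splitAt (step x⟶ x∉ P) (there c∈) with splitAt P c∈
  ... | as , bs , refl , P₁ , P₂ , as#bs =
    _ ∷ as , bs , refl , step x⟶ (x∉ ∘ ∈-++⁺ˡ) P₁ , P₂ ,
    λ { (here refl , x∈bs) → x∉ (∈-++⁺ʳ (_ ∷ as) x∈bs) ; (there u∈ , u∈bs) → as#bs (u∈ , u∈bs) }

  suffix : ∀ m → DPath x z xs → m ≤ length xs →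
           Σ V λ y → Σ (List V) λ ys → DPath y z ys × length ys ≡ m × ∃ λ as → x ∷ xs ≡ as ++ y ∷ ys
  suffix {xs = xs} m P m≤ with m ℕ.≟ length xs
  ... | yes refl = _ , _ , P , refl , [] , refl
  suffix {x = x} m (step _ _ P) m≤ | no m≢ with suffix m P (m<1+n⇒m≤n (≤∧≢⇒< m≤ m≢))
  ... | y , ys , Q , len , as , eq = y , ys , Q , len , x ∷ as , cong (x ∷_) eq
  suffix m [] z≤n | no m≢ = ⊥-elim (m≢ refl)

  toOPath : DPath x y xs → OPath x (replicate (length xs) true) y xs
  toOPath []               = []
  toOPath (step x⟶ x∉ P) = step x⟶ x∉ (toOPath P)

  converse : DPath x y xs →
             Σ (List V) λ ys → OPath y (replicate (length xs) false) x ys × y ∷ ys ↭ x ∷ xs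
  converse []                                     = [] , [] , ↭-refl
  converse {x} (step {y = z} {ys = zs} x⟶z x∉ P) with converse P
  ... | ys , P⁻ , P⁻↭P =
    ys ++ [ x ] ,
    subst (λ ds → OPath _ ds x (ys ++ [ x ])) (replicate-∷ʳ (length zs) false)
          (OPath-++ P⁻ (step {b = false} x⟶z z∉[x] []) λ { (x∈ , here refl) → x∉ (∈-resp-↭ P⁻↭P x∈) }) ,
    ↭-trans (++-comm (_ ∷ ys) [ x ]) (prep x P⁻↭P)
    where
    z∉[x] : z ∉ₗ [ x ]
    z∉[x] (here refl) = x∉ (here refl)

  vertexAt : OPath x ds z xs → Fin (suc (length ds)) → V
  vertexAt {x = x} _ zero    = x
  vertexAt (step _ _ O) (suc i) = vertexAt O i

  vertexAt∈ : (O : OPath x ds z xs) → ∀ i → vertexAt O i ∈ₗ x ∷ xs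
  vertexAt∈ _            zero    = here refl
  vertexAt∈ (step _ _ O) (suc i) = there (vertexAt∈ O i)

  vertexAt-injective : (O : OPath x ds z xs) → Injective _≡_ _≡_ (vertexAt O)
  vertexAt-injective _             {zero}  {zero}  _  = refl
  vertexAt-injective (step _ x∉ O) {zero}  {suc j} eq = ⊥-elim (x∉ (subst (_∈ₗ _) (sym eq) (vertexAt∈ O j)))
  vertexAt-injective (step _ x∉ O) {suc i} {zero}  eq = ⊥-elim (x∉ (subst (_∈ₗ _) eq (vertexAt∈ O i)))
  vertexAt-injective (step _ _ O)  {suc i} {suc j} eq = cong suc (vertexAt-injective O eq)

  stepAt : (O : OPath x ds z xs) (j : Fin (length ds)) →
           T (if List.lookup ds j then arc D (vertexAt O (inject₁ j)) (vertexAt O (suc j))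
                                  else arc D (vertexAt O (suc j)) (vertexAt O (inject₁ j)))
  stepAt (step s _ _) zero    = s
  stepAt (step _ _ O) (suc j) = stepAt O j

  toContains : OPath v ds z xs → ContainsOrientedPath D v ds
  toContains O = record { w = vertexAt O ; distinct = vertexAt-injective O ; initial = refl ; arcs = stepAt O }

  -- Reachability

  Reaches : Subset (n D) → V → V → Set
  Reaches A u v = Σ (List V) λ xs → DPath u v xs × All (_∈ A) (u ∷ xs)

  reaches-step : u ∈ A → u ⟶ w → Reaches (A - u) w v → Reaches A u v
  reaches-step {u = u} {A = A} u∈A u⟶w (ws , P , ws∈A-u) =
    _ ∷ ws , step u⟶w (All∈p-x⇒x∉ ws∈A-u) P , u∈A ∷ All.map (p─q⊆p A ⁅ u ⁆) ws∈A-u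

  reaches-unstep : u ≢ v → Reaches A u v → Σ V λ w → u ⟶ w × Reaches (A - u) w v
  reaches-unstep u≢v (_ , [] , _) = ⊥-elim (u≢v refl)
  reaches-unstep _ (_ ∷ ws , step u⟶w u∉ P , _ ∷ ws∈A) = _ , u⟶w , ws , P , All∈p⇒All∈p-x ws∈A u∉

  reaches? : ∀ A → Acc _<_ ∣ A ∣ → ∀ u v → Dec (Reaches A u v)
  reaches? A (acc rs) u v with u ∈? A
  ... | no u∉A = no λ { (_ , _ , u∈A ∷ _) → u∉A u∈A }
  ... | yes u∈A with u ≟ v
  ...   | yes refl = yes ([] , [] , u∈A ∷ [])
  ...   | no  u≢v  = map′ (λ (w , u⟶w , r) → reaches-step u∈A u⟶w r) (reaches-unstep u≢v)
                       (any? λ w → T? (arc D u w) ×-dec reaches? (A - u) (rs (x∈p⇒∣p-x∣<∣p∣ u∈A)) w v)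

  reachers : Subset (n D) → V → Subset (n D)
  reachers A v = tabulate λ u → ⌊ reaches? A (<-wellFounded ∣ A ∣) u v ⌋

  ∈-reachers⁺ : Reaches A u v → u ∈ reachers A v
  ∈-reachers⁺ {A} {u} {v} r = ∈-tabulate⁺ (fromWitness {a? = reaches? A (<-wellFounded ∣ A ∣) u v} r)

  ∈-reachers⁻ : u ∈ reachers A v → Reaches A u v
  ∈-reachers⁻ {u} {A} {v} u∈ = toWitness {a? = reaches? A (<-wellFounded ∣ A ∣) u v} (∈-tabulate⁻ u∈)

  reaches-back : u ∈ A → u ⟶ w → Reaches A w v → Reaches A u v
  reaches-back {u = u} {w = w} u∈A u⟶w (ws , P , ws∈A) with u ∈ₗ? w ∷ ws
  ... | no  u∉  = w ∷ ws , step u⟶w u∉ P , u∈A ∷ ws∈A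
  ... | yes u∈ with splitAt P u∈
  ...   | as , bs , refl , _ , Q , _ = bs , Q , u∈A ∷ All.++⁻ʳ as (All.tail ws∈A)

  -- Long paths into a vertex

  OutNeighboursOn : Subset (n D) → V → List V → Set
  OutNeighboursOn A t vs = ∀ {w} → w ∈ A → t ⟶ w → w ∈ₗ vs

  maximalPath : ∀ A → Acc _<_ ∣ A ∣ → x ∈ A →
                Σ V λ t → Σ (List V) λ xs → DPath x t xs × All (_∈ A) (x ∷ xs) × OutNeighboursOn A t (x ∷ xs)
  maximalPath {x = x} A (acc rs) x∈A with any? (λ z → z ∈? A - x ×-dec T? (arc D x z))
  ... | no  stuck = x , [] , [] , x∈A ∷ [] ,
                    λ w∈A x⟶w → ⊥-elim (stuck (_ , x∈p∧x≢y⇒x∈p-y w∈A (≢-sym (⟶-irrefl x⟶w)) , x⟶w))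
  ... | yes (z , z∈A-x , x⟶z) with maximalPath (A - x) (rs (x∈p⇒∣p-x∣<∣p∣ x∈A)) z∈A-x
  ...   | t , zs , P , zs∈A-x , saturated =
          t , z ∷ zs , step x⟶z (All∈p-x⇒x∉ zs∈A-x) P , x∈A ∷ All.map (p─q⊆p A ⁅ x ⁆) zs∈A-x , saturated′
    where
    saturated′ : OutNeighboursOn A t (x ∷ z ∷ zs)
    saturated′ {w} w∈A t⟶w with w ≟ x
    ... | yes refl = here refl
    ... | no  w≢x  = there (saturated (x∈p∧x≢y⇒x∈p-y w∈A w≢x) t⟶w)

  record Exit (U : Subset (n D)) (x : V) (xs : List V) : Set where
    field
      {last next}   : V
      {prefix rest} : List V
      path          : DPath x last prefix
      prefix∈U      : All (_∈ U) (x ∷ prefix)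
      leaves        : last ⟶ next
      next∉U        : next ∉ U
      split         : xs ≡ prefix ++ next ∷ rest

  exit? : ∀ U → DPath x z xs → x ∈ U → All (_∈ U) (x ∷ xs) ⊎ Exit U x xs
  exit? U [] x∈U = inj₁ (x∈U ∷ [])
  exit? U (step {y = y} x⟶y x∉ P) x∈U with y ∈? U
  ... | no  y∉U = inj₂ record { path = [] ; prefix∈U = x∈U ∷ [] ; leaves = x⟶y ; next∉U = y∉U ; split = refl }
  ... | yes y∈U with exit? U P y∈U
  ...   | inj₁ P∈U = inj₁ (x∈U ∷ P∈U)
  ...   | inj₂ e   = inj₂ record
          { path     = step x⟶y (subst (λ l → _ ∉ₗ y ∷ l) split x∉ ∘ ∈-++⁺ˡ) path
          ; prefix∈U = x∈U ∷ prefix∈U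
          ; leaves   = leaves
          ; next∉U   = next∉U
          ; split    = cong (y ∷_) split
          }
    where open Exit e

  closingArc : DPath x t xs → OutNeighboursOn A t (x ∷ xs) → w ∈ A → t ⟶ w →
               Σ V λ a → Σ (List V) λ cs →
                 DPath a t cs × t ⟶ a × OutNeighboursOn A t (a ∷ cs) × ∃ λ as → x ∷ xs ≡ as ++ a ∷ cs
  closingArc [] saturated w∈A t⟶w with saturated w∈A t⟶w
  ... | here refl = ⊥-elim (⟶-irrefl t⟶w refl)
  closingArc {x = x} {t = t} P@(step _ _ Q) saturated w∈A t⟶w with T? (arc D t x)
  ... | yes t⟶x = x , _ , P , t⟶x , saturated , [] , refl
  ... | no ¬t⟶x with closingArc Q saturated′ w∈A t⟶w
    where
    saturated′ : OutNeighboursOn _ t _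
    saturated′ u∈A t⟶u with saturated u∈A t⟶u
    ... | here refl = ⊥-elim (¬t⟶x t⟶u)
    ... | there u∈  = u∈
  ...   | a , cs , C , t⟶a , sat , as , eq = a , cs , C , t⟶a , sat , x ∷ as , cong (x ∷_) eq

  closingCycle : ∀ {d} → MinOutDegIn A (suc d) →
                 DPath x t xs → All (_∈ A) (x ∷ xs) → OutNeighboursOn A t (x ∷ xs) →
                 Σ V λ a → Σ (List V) λ cs →
                   DPath a t cs × t ⟶ a × suc d ≤ length cs × ∃ λ as → x ∷ xs ≡ as ++ a ∷ cs
  closingCycle {A = A} {t = t} δ P P∈A saturated =
    let w , w∈A , t⟶w                   = outNeighbour (≤-trans (s≤s z≤n) (δ t∈A))
        a , cs , C , t⟶a , sat , split = closingArc P saturated w∈A t⟶w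
    in a , cs , C , t⟶a , ≤-trans (δ t∈A) (m<1+n⇒m≤n (∣p∣<length (N⁺∩A⊆ sat) (DPath-end∈ C) t∉)) , split
    where
    t∈A : t ∈ A
    t∈A = All.lookup P∈A (DPath-end∈ P)
    N⁺∩A⊆ : ∀ {vs} → OutNeighboursOn A t vs → ∀ {u} → u ∈ A ∩ N⁺ t → u ∈ₗ vs
    N⁺∩A⊆ sat u∈ = let u∈A , u∈N⁺ = x∈p∩q⁻ A (N⁺ t) u∈ in sat u∈A (∈-tabulate⁻ u∈N⁺)
    t∉ : t ∉ A ∩ N⁺ t
    t∉ t∈ = ⟶-irrefl (∈-tabulate⁻ (proj₂ (x∈p∩q⁻ A (N⁺ t) t∈))) refl

  record LastVisit (C : List V) (x z : V) (xs : List V) : Set where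
    field
      {vertex}       : V
      {before after} : List V
      visited        : vertex ∈ₗ C
      path           : DPath vertex z after
      after∉C        : All (_∉ₗ C) after
      split          : x ∷ xs ≡ before ++ vertex ∷ after

  lastVisit : ∀ C → DPath x z xs → All (_∉ₗ C) (x ∷ xs) ⊎ LastVisit C x z xs
  lastVisit {x = x} C [] with x ∈ₗ? C
  ... | yes x∈C = inj₂ record { before = [] ; visited = x∈C ; path = [] ; after∉C = [] ; split = refl }
  ... | no  x∉C = inj₁ (x∉C ∷ [])
  lastVisit {x = x} C P@(step _ _ Q) with lastVisit C Q
  ... | inj₂ visit = inj₂ record { LastVisit visit ; before = x ∷ LastVisit.before visit
                                 ; split = cong (x ∷_) (LastVisit.split visit) }
  ... | inj₁ Q∉C with x ∈ₗ? C
  ...   | yes x∈C = inj₂ record { before = [] ; visited = x∈C ; path = P ; after∉C = Q∉C ; split = refl }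
  ...   | no  x∉C = inj₁ (x∉C ∷ Q∉C)

  rotate : DPath a t cs → t ⟶ a → c ∈ₗ a ∷ cs →
           Σ V λ c′ → Σ (List V) λ rs → DPath c′ c rs × c′ ∷ rs ↭ a ∷ cs
  rotate {a = a} C t⟶a c∈ with splitAt C c∈
  ... | as , [] , refl , C₁ , [] , _ =
        a , as , C₁ , ↭-reflexive (cong (a ∷_) (sym (++-identityʳ as)))
  ... | as , b ∷ bs , refl , C₁ , step _ _ C₂ , as#bs =
        b , bs ++ a ∷ as ,
        DPath-++ C₂ (step t⟶a (λ t∈ → as#bs (t∈ , DPath-end∈ C₂)) C₁) (λ (u∈bs , u∈as) → as#bs (u∈as , u∈bs)) ,
        ++-comm (b ∷ bs) (a ∷ as)

  pathIntoFromCycle : DPath a t cs → t ⟶ a → All (_∈ A) (a ∷ cs) → Reaches A a v →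
                      Σ V λ y → Σ (List V) λ zs → DPath y v zs × length cs ≤ length zs × All (_∈ A) (y ∷ zs)
  pathIntoFromCycle {cs = cs} {A = A} C t⟶a C∈A (_ , R , R∈A) with lastVisit (_ ∷ cs) R
  ... | inj₁ (a∉C ∷ _) = ⊥-elim (a∉C (here refl))
  ... | inj₂ visit with rotate C t⟶a (LastVisit.visited visit)
  ...   | c′ , rs , Rot , Rot↭C = c′ , rs ++ after , DPath-++ Rot path Rot#after , cs≤ , Rot++after∈A
    where
    open LastVisit visit
    Rot#after : Disjoint (c′ ∷ rs) after
    Rot#after (u∈Rot , u∈after) = All.lookup after∉C u∈after (∈-resp-↭ Rot↭C u∈Rot)
    cs≤ : length cs ≤ length (rs ++ after)
    cs≤ = begin
      length cs                ≡⟨ suc-injective (↭-length (↭-sym Rot↭C)) ⟩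
      length rs                ≤⟨ m≤m+n (length rs) (length after) ⟩
      length rs + length after ≡⟨ sym (length-++ rs) ⟩
      length (rs ++ after)     ∎
      where open ≤-Reasoning
    Rot++after∈A : All (_∈ A) (c′ ∷ rs ++ after)
    Rot++after∈A = All.++⁺ (All-resp-↭ (↭-sym Rot↭C) C∈A) (All.tail (All-suffix before split R∈A))

  pathIntoOfLength : ∀ {d m} → MinOutDegIn A (suc d) → m ≤ suc d →
                     DPath v t xs → All (_∈ A) (v ∷ xs) → OutNeighboursOn A t (v ∷ xs) →
                     All (λ u → Reaches A u v) (v ∷ xs) →
                     Σ V λ y → Σ (List V) λ zs → DPath y v zs × length zs ≡ m × All (_∈ A) (y ∷ zs)
  pathIntoOfLength {m = m} δ m≤ P P∈A saturated reach with closingCycle δ P P∈A saturated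
  ... | a , cs , C , t⟶a , d<cs , as , split
    with pathIntoFromCycle C t⟶a (All-suffix as split P∈A) (All.head (All-suffix as split reach))
  ... | _ , _ , Z , cs≤zs , Z∈A with suffix m Z (≤-trans m≤ (≤-trans d<cs cs≤zs))
  ... | y , zs , Z′ , len , bs , split′ = y , zs , Z′ , len , All-suffix bs split′ Z∈A

  -- Realising P(k₁,…,k_ℓ) block by block

  record OPathIn (A : Subset (n D)) (v : V) (ds : List Bool) : Set where
    field
      {end}  : V
      {rest} : List V
      path   : OPath v ds end rest
      rest∈A : All (_∈ A) rest

  Realisation : ∀ {ℓ} → Subset (n D) → V → Vec ℕ ℓ → Set
  Realisation A v k = Σ (Vec ℕ _) λ k′ → Conforms k k′ × OPathIn A v (orientation (toList k′))

  RealisableBelow : ℕ → Set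
  RealisableBelow μ = ∀ {ℓ} (k : Vec ℕ ℓ) A → ∣ A ∣ + ℓ < μ →
                      ∀ {v} → v ∈ A → MinOutDegIn A (sum k) → Realisation A v k

  realiseForwardStep : ∀ {ℓ k₁} {k : Vec ℕ ℓ} → RealisableBelow (∣ A ∣ + suc ℓ) → v ∈ A →
                       MinOutDegIn A (suc k₁ + sum k) → Realisation A v (suc k₁ ∷ k)
  realiseForwardStep {A = A} {v = v} {k₁ = k₁} {k} realise v∈A δ with outNeighbour (≤-trans (s≤s z≤n) (δ v∈A))
  ... | z , z∈A , v⟶z = prepend (realise (k₁ ∷ k) (A - v) shrinks z∈A-v δ′)
    where
    z∈A-v : z ∈ A - v
    z∈A-v = x∈p∧x≢y⇒x∈p-y z∈A (≢-sym (⟶-irrefl v⟶z))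
    shrinks : ∣ A - v ∣ + _ < ∣ A ∣ + _
    shrinks = +-monoˡ-< _ (x∈p⇒∣p-x∣<∣p∣ v∈A)
    δ′ : MinOutDegIn (A - v) (k₁ + sum k)
    δ′ = MinOutDegIn-─ ⁅ v ⁆ δ (≤-reflexive (∣⁅x⁆∣≡1 v))
    prepend : Realisation (A - v) z (k₁ ∷ k) → Realisation A v (suc k₁ ∷ k)
    prepend (k₁′ ∷ k′ , conforms , record { path = O ; rest∈A = O∈A-v }) =
      suc k₁′ ∷ k′ , Conforms-head s≤s conforms ,
      record { path   = step v⟶z (All∈p-x⇒x∉ (z∈A-v ∷ O∈A-v)) O
             ; rest∈A = z∈A ∷ All.map (p─q⊆p A ⁅ v ⁆) O∈A-v }

  realiseViaExit : ∀ {ℓ j} {k : Vec ℕ ℓ} → RealisableBelow (∣ A ∣ + suc (suc ℓ)) → v ∈ A →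
                   MinOutDegIn A (suc j + sum k) → All (_∈ A) (v ∷ xs) → Exit (reachers A v) v xs →
                   Realisation A v (0 ∷ suc j ∷ k)
  realiseViaExit {A = A} {v = v} {j = j} {k} realise v∈A δ P∈A exit =
    prepend (realise (0 ∷ suc j ∷ k) (A ─ U) shrinks (x∈p∧x∉q⇒x∈p─q next∈A next∉U) δ′)
    where
    open Exit exit
    U : Subset (n D)
    U = reachers A v
    shrinks : ∣ A ─ U ∣ + _ < ∣ A ∣ + _
    shrinks = +-monoˡ-< _ (p∩q≢∅⇒∣p─q∣<∣p∣ A U (v , x∈p∩q⁺ (v∈A , ∈-reachers⁺ ([] , [] , v∈A ∷ []))))
    P′∈A : All (_∈ A) (prefix ++ next ∷ rest)
    P′∈A = subst (All (_∈ A)) split (All.tail P∈A)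
    next∈A : next ∈ A
    next∈A = All.head (All.++⁻ʳ prefix P′∈A)
    δ′ : MinOutDegIn (A ─ U) (suc j + sum k)
    δ′ u∈ = ≤-trans (δ (p─q⊆p A U u∈)) (deg-mono {A = A} λ w∈A u⟶w → x∈p∧x∉q⇒x∈p─q w∈A λ w∈U →
      x∈p─q⇒x∉q u∈ (∈-reachers⁺ (reaches-back (p─q⊆p A U u∈) u⟶w (∈-reachers⁻ w∈U))))
    prepend : Realisation (A ─ U) next (0 ∷ suc j ∷ k) → Realisation A v (0 ∷ suc j ∷ k)
    prepend (k₁′ ∷ k′ , conforms , record { rest = rs ; path = O ; rest∈A = O∈A─U }) =
      length prefix + suc k₁′ ∷ k′ , Conforms-head (λ _ → z≤n) conforms ,
      record { path   = subst (λ ds → OPath v ds _ _) (sym (replicate-+-++ (length prefix) (suc k₁′) true _))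
                              (OPath-++ (toOPath path) (step leaves last∉O O) separated)
             ; rest∈A = All.++⁺ (All.++⁻ˡ prefix P′∈A) (next∈A ∷ All.map (p─q⊆p A U) O∈A─U) }
      where
      separated : Disjoint (v ∷ prefix) (next ∷ rs)
      separated (u∈prefix , u∈O) =
        All.lookup (next∉U ∷ All.map x∈p─q⇒x∉q O∈A─U) u∈O (All.lookup prefix∈U u∈prefix)
      last∉O : last ∉ₗ next ∷ rs
      last∉O last∈O = separated (DPath-end∈ path , last∈O)

  realiseViaPathInto : ∀ {ℓ j} {k : Vec ℕ ℓ} → RealisableBelow (∣ A ∣ + suc (suc ℓ)) →
                       MinOutDegIn A (suc j + sum k) → DPath y v zs → length zs ≡ suc j → All (_∈ A) (y ∷ zs) →
                       Realisation A v (0 ∷ suc j ∷ k)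
  realiseViaPathInto {A = A} {y = y} {v = v} {zs = zs} {ℓ = ℓ} {j} {k} realise δ Z len Z∈A =
    prepend (realise k (A ─ Zs) shrinks y∈A─Zs (MinOutDegIn-─ {s = suc j} {d = sum k} Zs δ ∣Zs∣≤))
    where
    Zs : Subset (n D)
    Zs = fromList zs
    shrinks : ∣ A ─ Zs ∣ + ℓ < ∣ A ∣ + suc (suc ℓ)
    shrinks = +-mono-≤-< (∣p─q∣≤∣p∣ A Zs) (m<n⇒m<1+n (n<1+n ℓ))
    y∈A─Zs : y ∈ A ─ Zs
    y∈A─Zs = x∈p∧x∉q⇒x∈p─q (All.head Z∈A) (DPath-start∉ Z ∘ ∈-fromList⁻)
    ∣Zs∣≤ : ∣ Zs ∣ ≤ suc j
    ∣Zs∣≤ = ≤-trans (∣fromList∣≤length zs) (≤-reflexive len)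
    prepend : Realisation (A ─ Zs) y k → Realisation A v (0 ∷ suc j ∷ k)
    prepend (k′ , conforms , record { end = e ; rest = rs ; path = O ; rest∈A = O∈A─Zs }) with converse Z
    ... | ys , Z⁻ , Z⁻↭Z = 0 ∷ suc j ∷ k′ , Conforms-∷∷ conforms ,
          record { path   = subst (λ m → OPath v (replicate m false ++ orientation (toList k′)) e (ys ++ rs))
                                  len (OPath-++ Z⁻ O separated)
                 ; rest∈A = All.++⁺ (All.tail (All-resp-↭ (↭-sym Z⁻↭Z) Z∈A)) (All.map (p─q⊆p A Zs) O∈A─Zs) }
      where
      separated : Disjoint (v ∷ ys) rs
      separated (u∈Z⁻ , u∈rs) with ∈-resp-↭ Z⁻↭Z u∈Z⁻
      ... | here refl  = OPath-start∉ O u∈rs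
      ... | there u∈zs = x∈p─q⇒x∉q (All.lookup O∈A─Zs u∈rs) (∈-fromList⁺ u∈zs)

  realiseBackwardBlock : ∀ {ℓ j} {k : Vec ℕ ℓ} → RealisableBelow (∣ A ∣ + suc (suc ℓ)) → v ∈ A →
                         MinOutDegIn A (suc j + sum k) → Realisation A v (0 ∷ suc j ∷ k)
  realiseBackwardBlock {A = A} {v = v} {j = j} {k = k} realise v∈A δ
    with maximalPath A (<-wellFounded ∣ A ∣) v∈A
  ... | t , xs , P , P∈A , saturated with exit? (reachers A v) P (∈-reachers⁺ ([] , [] , v∈A ∷ []))
  ...   | inj₂ exit = realiseViaExit realise v∈A δ P∈A exit
  ...   | inj₁ P∈U  =
    let _ , _ , Z , len , Z∈A = pathIntoOfLength {A = A} {d = j + sum k} δ (s≤s (m≤m+n j (sum k)))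
                                                 P P∈A saturated (All.map ∈-reachers⁻ P∈U)
    in realiseViaPathInto realise δ Z len Z∈A

  -- Every step deletes a vertex or consumes two blocks, so ∣ A ∣ + ℓ decreases.
  realise : ∀ {ℓ} (k : Vec ℕ ℓ) A → Acc _<_ (∣ A ∣ + ℓ) → v ∈ A → MinOutDegIn A (sum k) → Realisation A v k
  realise []              A _        _ _ = [] , Conforms-refl {k = []} , record { path = [] ; rest∈A = [] }
  realise (0 ∷ [])        A _        _ _ =
    0 ∷ [] , Conforms-refl {k = 0 ∷ []} , record { path = [] ; rest∈A = [] }
  realise (suc k₁ ∷ k)    A (acc rs) = realiseForwardStep (λ k A lt → realise k A (rs lt))
  realise (0 ∷ suc j ∷ k) A (acc rs) = realiseBackwardBlock (λ k A lt → realise k A (rs lt))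
  realise (0 ∷ 0 ∷ k)     A (acc rs) v∈A δ =
    let k′ , conforms , O = realise k A (rs (+-monoʳ-< ∣ A ∣ (m<n⇒m<1+n (n<1+n _)))) v∈A δ
    in 0 ∷ 0 ∷ k′ , Conforms-∷∷ conforms , O

theorem19 : (ℓ : ℕ) → 1 ≤ ℓ → (k : Vec ℕ ℓ) →
    (∀ (i : Fin ℓ) → 1 ≤ toℕ i → 1 ≤ lookup k i) →
    (D : Digraph) → MinOutDegGE D (sum k) →
    (v : Fin (n D)) →
    Σ (Vec ℕ ℓ) λ k′ →
      (∀ (i : Fin ℓ) → (PaperIndexOdd i → lookup k i ≤ lookup k′ i)
                     × (¬ PaperIndexOdd i → lookup k′ i ≡ lookup k i))
      × ContainsP D v (toList k′)
theorem19 ℓ _ k _ D δ v =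
  let k′ , conforms , O = realise D k ⊤ (<-wellFounded _) ∈⊤ (MinOutDegIn-⊤ D δ)
  in k′ , conforms , toContains D (OPathIn.path O)
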